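{- For an integer $n\ge 2$ let $\mathtt{A}=[a_{ij}]$ be the $n\times n$ matrix with $a_{ij}=1$ if $j=i+1$ or $i+j=n+1$, and $a_{ij}=0$ otherwise, and write $\mathtt{A}^m=[a_{ij}^{(m)}]$. Let $\alpha_0,\dots,\alpha_n$ be the coefficients of $P_n(\lambda)=\alpha_0\lambda^n+\dots+\alpha_n$ given by $$P_n(\lambda)=\begin{cases}\displaystyle\sum_{k=1}^{[\frac{n+2}{4}]+1}(-1)^{k-1}\binom{\frac n2-k+2}{k-1}\lambda^{n-2k+2}, & n \text{ even},\\[3ex] \displaystyle\sum_{k=1}^{[\frac{n+2}{4}]+2}(-1)^{k-1}\left(\binom{\frac{n+3}{2}-k}{k-1}+\binom{\frac{n+3}{2}-k}{k-2}\lambda\right)\lambda^{n-2k+2}, & n \text{ odd}.\end{cases}$$ Then for each $(i,j)\in\{1,\dots,n\}^2$ and all $m>n$, $$\alpha_0a_{ij}^{(m)}+\alpha_1a_{ij}^{(m-1)}+\dots+\alpha_na_{ij}^{(m-n)}=0,$$ so that each $a_{ij}^{(m)}$ is the solution of this recurrence with initial values $a_{ij}^{(1)},\dots,a_{ij}^{(n)}$; and the number $f(k)$ of sequences $(i_1,\dots,i_k)\in\{1,\dots,n\}^k$ with $a_{i_ti_{t+1}}=1$ for $t=1,\dots,k-1$ equals $f(k)=v_n\mathtt{A}^{k-1}v_n^T=\sum_{i,j}a_{ij}^{(k-1)}$, where $v_n=[1\ \cdots\ 1]_{1\times n}$ and $\mathtt{A}^0=\mathtt{I}$.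
   Context: $f(k)$ is the number of meaningful compositions of order $k$ of the maps $\nabla_1,\dots,\nabla_n$ (going up $A_0\to A_1\to\cdots\to A_{[n/2]}$ and back down to $A_0$), $a_{ij}=1$ meaning $\nabla_j\circ\nabla_i$ is meaningful. $[x]$ is the integer part; $\binom{a}{b}=0$ if $b<0$ or $b>a$. The polynomial $P_n$ equals $(-1)^n|\mathtt{A}-\lambda\mathtt{I}|$. -}

module Defs where

open import Data.Nat as ℕ using (ℕ; zero; suc; _∸_; _≟_)
open import Data.Nat.Combinatorics using (_C_)
open import Data.Nat.DivMod using (_/_)
open import Data.Integer as ℤ using (ℤ; +_; -_)
open import Data.Fin as Fin using (Fin; toℕ)
open import Data.Vec using (Vec; []; _∷_)
open import Data.Bool using (Bool; true; false; if_then_else_; _∨_)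
open import Data.Unit using (⊤)
open import Data.Product using (_×_)
open import Relation.Nullary.Decidable using (⌊_⌋)
open import Relation.Binary.PropositionalEquality using (_≡_)

-- n × n matrices over ℤ, indices 0-based (Fin n), i.e. entry (i,j) of the
-- paper is M (i-1) (j-1).
Matrix : ℕ → Set
Matrix n = Fin n → Fin n → ℤ

sumFin : ∀ {n} → (Fin n → ℤ) → ℤ
sumFin {zero}  f = + 0
sumFin {suc n} f = f Fin.zero ℤ.+ sumFin (λ i → f (Fin.suc i))

sumUpTo : ℕ → (ℕ → ℤ) → ℤ
sumUpTo zero    g = g 0
sumUpTo (suc r) g = sumUpTo r g ℤ.+ g (suc r)

sum1to : ℕ → (ℕ → ℤ) → ℤ
sum1to zero    g = + 0
sum1to (suc r) g = sum1to r g ℤ.+ g (suc r)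

identity : ∀ {n} → Matrix n
identity i j = if ⌊ toℕ i ≟ toℕ j ⌋ then + 1 else + 0

_⊗_ : ∀ {n} → Matrix n → Matrix n → Matrix n
(M ⊗ N) i j = sumFin (λ l → M i l ℤ.* N l j)

_^^_ : ∀ {n} → Matrix n → ℕ → Matrix n
M ^^ zero  = identity
M ^^ suc m = M ⊗ (M ^^ m)

-- The matrix A: a_ij = 1 iff j = i+1 or i+j = n+1 (1-based indices).
-- With 0-based i', j' (i = i'+1, j = j'+1): j' = i'+1  or  i'+j'+2 = n+1.
A : (n : ℕ) → Matrix n
A n i j =
  if ⌊ toℕ j ≟ suc (toℕ i) ⌋ ∨ ⌊ toℕ i ℕ.+ toℕ j ℕ.+ 2 ≟ suc n ⌋
  then + 1 else + 0

[_≐_] : ℕ → ℕ → ℤ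
[ a ≐ b ] = if ⌊ a ≟ b ⌋ then + 1 else + 0

-- (-1)^(k-1)
sgn : ℕ → ℤ
sgn zero          = - (+ 1)          -- (-1)^(-1) = -1 (never used: k ≥ 1)
sgn (suc zero)    = + 1
sgn (suc (suc k)) = - sgn (suc k)

-- binomial coefficient with lower index k - 2 (zero when k - 2 < 0, i.e. k < 2)
binomLowerMinus2 : ℕ → ℕ → ℤ
binomLowerMinus2 a zero          = + 0
binomLowerMinus2 a (suc zero)    = + 0
binomLowerMinus2 a (suc (suc k)) = + (a C k)

even? : ℕ → Bool
even? zero          = true
even? (suc zero)    = false
even? (suc (suc n)) = even? n

-- Coefficient of λ^e in P_n(λ).
-- even n : Σ_{k=1}^{[(n+2)/4]+1} (-1)^{k-1} C(n/2-k+2, k-1) λ^{n-2k+2}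
-- odd  n : Σ_{k=1}^{[(n+2)/4]+2} (-1)^{k-1} ( C((n+3)/2-k, k-1) λ^{n-2k+2}
--                                           + C((n+3)/2-k, k-2) λ^{n-2k+3} )
-- The monomial λ^{n-2k+2} contributes to the coefficient of λ^e iff
-- e + 2k = n + 2 (similarly e + 2k = n + 3 for λ^{n-2k+3}).
coeffP : (n e : ℕ) → ℤ
coeffP n e with even? n
... | true  = sum1to ((n ℕ.+ 2) / 4 ℕ.+ 1) λ k →
    sgn k ℤ.* (+ ((n / 2 ℕ.+ 2 ∸ k) C (k ∸ 1))) ℤ.* [ e ℕ.+ 2 ℕ.* k ≐ n ℕ.+ 2 ]
... | false = sum1to ((n ℕ.+ 2) / 4 ℕ.+ 2) λ k →
    sgn k ℤ.* ( (+ (((n ℕ.+ 3) / 2 ∸ k) C (k ∸ 1))) ℤ.* [ e ℕ.+ 2 ℕ.* k ≐ n ℕ.+ 2 ]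
              ℤ.+ binomLowerMinus2 ((n ℕ.+ 3) / 2 ∸ k) k ℤ.* [ e ℕ.+ 2 ℕ.* k ≐ n ℕ.+ 3 ] )

-- α_t = coefficient of λ^{n-t} in P_n(λ) = α_0 λ^n + ... + α_n
α : (n t : ℕ) → ℤ
α n t = coeffP n (n ∸ t)

IsChain : ∀ {n k} → Matrix n → Vec (Fin n) k → Set
IsChain M []           = ⊤
IsChain M (x ∷ [])     = ⊤
IsChain M (x ∷ y ∷ v)  = (M x y ≡ + 1) × IsChain M (y ∷ v)

-- Let L be the action of A on column vectors and U_k the Chebyshev operators U_0 = I,
-- U_1 = L, U_{k+2} = L U_{k+1} - U_k, whose expansion Σ_j (-1)^j C(k-j, j) L^(k-2j) follows
-- from Pascal's rule. Rearranging the sums that define P_n gives P_n(L) = U_{h+1} L^(h-1)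
-- for n = 2h and P_n(L) = (U_{h+1} - U_h) L^h for n = 2h + 1. The columns c_k = L e_k of A
-- satisfy c_0 = e_{n-1}, c_{k+1} = e_k + e_{n-2-k} (a single term when the indices agree) and
-- c_k = c_{n-k}; hence L c_{k+1} = c_k + c_{k+2} below the middle, U_j c_0 = c_j for 2j ≤ n,
-- and every column is a Chebyshev image of c_0. The operator U_{h+1} (resp. U_{h+1} - U_h)
-- commutes with L and kills c_0, so it kills every column and thus the image of L, which
-- contains the image of L^(h-1) (for n = 2 because A² = I). Hence P_n(A) = 0, and the
-- recurrence is P_n(A) A^(m-n) = 0 read entrywise. Chains of length k+1 starting at i are
-- counted by the i-th row sum of A^k.

module Submission where

open import Defs
open import Data.Nat using (ℕ; suc; _≤_; _<_; _∸_)
open import Data.Integer using (ℤ; +_; _*_)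
open import Data.Fin using (Fin)
open import Data.Vec using (Vec)
open import Data.Product using (Σ; Σ-syntax; _×_)
open import Function.Bundles using (_↔_)
open import Relation.Binary.PropositionalEquality using (_≡_)

open import Data.Bool using (Bool; true; false; if_then_else_; _∨_)
open import Data.Bool.Properties using (∨-comm; ∨-idem)
open import Data.Fin using (toℕ; zero; suc)
open import Data.Fin.Properties using (toℕ<n; +↔⊎)
open import Data.Integer as ℤ using (-_; _+_; _-_)
import Data.Integer.Properties as ℤP
open import Algebra.Properties.Semiring.Sum ℤP.+-*-semiring
  using (sum; ∑-distrib-+; ∑-comm; *-distribˡ-sum)
open import Data.Integer.Tactic.RingSolver using (solve-∀)
open import Data.Nat as ℕ using (zero; z≤n; s≤s; _≟_; _≤?_)
open import Data.Nat.Combinatorics using (_C_; nCk+nC[k+1]≡[n+1]C[k+1]; k>n⇒nCk≡0)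
open import Data.Nat.DivMod using (_/_; m*n/n≡m; /-monoˡ-≤)
import Data.Nat.Properties as ℕP
open import Data.Nat.Tactic.RingSolver using () renaming (solve-∀ to nsolve)
open import Data.Product using (_,_; proj₂)
import Data.Product.Function.Dependent.Propositional as Dependent
open import Data.Product.Function.NonDependent.Propositional using (_×-↔_)
open import Data.Sum using (_⊎_; inj₁; inj₂)
open import Data.Sum.Function.Propositional using (_⊎-↔_)
open import Data.Unit using (tt)
open import Data.Vec using ([]; _∷_)
open import Function using (_∘_)
open import Function.Bundles using (_⇔_; mk⇔; mk↔ₛ′)
import Function.Properties.Equivalence as ⇔
open import Function.Properties.Inverse using (↔-refl; ↔-trans)
open import Relation.Binary.PropositionalEquality
  using (_≢_; refl; sym; trans; cong; cong₂; subst; subst₂; module ≡-Reasoning)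
open import Relation.Nullary using (yes; no; contradiction)
open import Relation.Nullary.Decidable using (⌊_⌋; does; isYes≗does; does-⇔)

𝟙 : Bool → ℤ
𝟙 b = if b then + 1 else + 0

≟-cong : ∀ {a b c d} → (a ≡ b ⇔ c ≡ d) → ⌊ a ≟ b ⌋ ≡ ⌊ c ≟ d ⌋
≟-cong {a} {b} {c} {d} a≡b⇔c≡d = begin
  ⌊ a ≟ b ⌋     ≡⟨ isYes≗does (a ≟ b) ⟩
  does (a ≟ b)  ≡⟨ does-⇔ a≡b⇔c≡d (a ≟ b) (c ≟ d) ⟩
  does (c ≟ d)  ≡⟨ isYes≗does (c ≟ d) ⟨
  ⌊ c ≟ d ⌋     ∎
  where open ≡-Reasoning

≐-cong : ∀ {a b c d} → (a ≡ b ⇔ c ≡ d) → [ a ≐ b ] ≡ [ c ≐ d ]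
≐-cong a≡b⇔c≡d = cong 𝟙 (≟-cong a≡b⇔c≡d)

≐-sym : ∀ a b → [ a ≐ b ] ≡ [ b ≐ a ]
≐-sym a b = ≐-cong (mk⇔ sym sym)

≐-suc : ∀ a b → [ suc a ≐ suc b ] ≡ [ a ≐ b ]
≐-suc a b = ≐-cong (mk⇔ ℕP.suc-injective (cong suc))

≐-refl : ∀ a → [ a ≐ a ] ≡ + 1
≐-refl a with a ≟ a
... | yes _   = refl
... | no a≢a = contradiction refl a≢a

≐-≢ : ∀ {a b} → a ≢ b → [ a ≐ b ] ≡ + 0
≐-≢ {a} {b} a≢b with a ≟ b
... | yes a≡b = contradiction a≡b a≢b
... | no _    = refl

𝟙-01 : ∀ b → 𝟙 b ≡ + 0 ⊎ 𝟙 b ≡ + 1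
𝟙-01 false = inj₁ refl
𝟙-01 true  = inj₂ refl

𝟙-∨-≟ : ∀ t {k q} → k ≢ q → 𝟙 (⌊ t ≟ k ⌋ ∨ ⌊ t ≟ q ⌋) ≡ [ t ≐ k ] + [ t ≐ q ]
𝟙-∨-≟ t {k} {q} k≢q with t ≟ k | t ≟ q
... | yes refl | yes refl = contradiction refl k≢q
... | yes _    | no _     = refl
... | no _     | yes _    = refl
... | no _     | no _     = refl

sumFin≡sum : ∀ {m} (f : Fin m → ℤ) → sumFin f ≡ sum f
sumFin≡sum {zero}  f = refl
sumFin≡sum {suc m} f = cong (λ s → f zero + s) (sumFin≡sum (f ∘ suc))

sumFin-cong : ∀ {m} {f g : Fin m → ℤ} → (∀ i → f i ≡ g i) → sumFin f ≡ sumFin g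
sumFin-cong {zero}  f≗g = refl
sumFin-cong {suc m} f≗g = cong₂ _+_ (f≗g zero) (sumFin-cong (f≗g ∘ suc))

sumFin-zero : ∀ {m} {f : Fin m → ℤ} → (∀ i → f i ≡ + 0) → sumFin f ≡ + 0
sumFin-zero {zero}  f≗0 = refl
sumFin-zero {suc m} f≗0 = cong₂ _+_ (f≗0 zero) (sumFin-zero (f≗0 ∘ suc))

sumFin-+ : ∀ {m} (f g : Fin m → ℤ) → sumFin (λ i → f i + g i) ≡ sumFin f + sumFin g
sumFin-+ f g rewrite sumFin≡sum (λ i → f i + g i) | sumFin≡sum f | sumFin≡sum g = ∑-distrib-+ f g

sumFin-*ˡ : ∀ {m} c (f : Fin m → ℤ) → c * sumFin f ≡ sumFin (λ i → c * f i)
sumFin-*ˡ c f rewrite sumFin≡sum f | sumFin≡sum (λ i → c * f i) = *-distribˡ-sum c f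

sumFin-comm : ∀ {m k} (f : Fin m → Fin k → ℤ) →
  sumFin (λ i → sumFin (f i)) ≡ sumFin (λ j → sumFin (λ i → f i j))
sumFin-comm f = begin
  sumFin (λ i → sumFin (f i))          ≡⟨ sumFin-cong (λ i → sumFin≡sum (f i)) ⟩
  sumFin (λ i → sum (f i))             ≡⟨ sumFin≡sum (λ i → sum (f i)) ⟩
  sum (λ i → sum (f i))                ≡⟨ ∑-comm f ⟩
  sum (λ j → sum (λ i → f i j))        ≡⟨ sumFin≡sum (λ j → sum (λ i → f i j)) ⟨
  sumFin (λ j → sum (λ i → f i j))     ≡⟨ sumFin-cong (λ j → sumFin≡sum (λ i → f i j)) ⟨
  sumFin (λ j → sumFin (λ i → f i j))  ∎
  where open ≡-Reasoning

sumFin-pick : ∀ {m} (g : ℕ → ℤ) {k} → k < m → sumFin {m} (λ l → g (toℕ l) * [ toℕ l ≐ k ]) ≡ g k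
sumFin-pick {suc m} g {zero} _ = begin
  g 0 * + 1 + sumFin {m} (λ l → g (suc (toℕ l)) * + 0)
    ≡⟨ cong₂ _+_ (ℤP.*-identityʳ (g 0)) (sumFin-zero {m} (λ l → ℤP.*-zeroʳ (g (suc (toℕ l))))) ⟩
  g 0 + + 0
    ≡⟨ ℤP.+-identityʳ (g 0) ⟩
  g 0 ∎
  where open ≡-Reasoning
sumFin-pick {suc m} g {suc k} (s≤s k<m) = begin
  g 0 * + 0 + sumFin {m} (λ l → g (suc (toℕ l)) * [ suc (toℕ l) ≐ suc k ])
    ≡⟨ cong₂ _+_ (ℤP.*-zeroʳ (g 0))
                 (sumFin-cong {m} (λ l → cong (g (suc (toℕ l)) *_) (≐-suc (toℕ l) k))) ⟩
  + 0 + sumFin {m} (λ l → g (suc (toℕ l)) * [ toℕ l ≐ k ])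
    ≡⟨ ℤP.+-identityˡ _ ⟩
  sumFin {m} (λ l → g (suc (toℕ l)) * [ toℕ l ≐ k ])
    ≡⟨ sumFin-pick (g ∘ suc) k<m ⟩
  g (suc k) ∎
  where open ≡-Reasoning

sumUpTo-cong : ∀ r {f g : ℕ → ℤ} → (∀ t → t ≤ r → f t ≡ g t) → sumUpTo r f ≡ sumUpTo r g
sumUpTo-cong zero    f≗g = f≗g 0 z≤n
sumUpTo-cong (suc r) f≗g =
  cong₂ _+_ (sumUpTo-cong r (λ t t≤r → f≗g t (ℕP.m≤n⇒m≤1+n t≤r))) (f≗g (suc r) ℕP.≤-refl)

sumUpTo-head : ∀ r (f : ℕ → ℤ) → sumUpTo (suc r) f ≡ f 0 + sumUpTo r (f ∘ suc)
sumUpTo-head zero    f = refl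
sumUpTo-head (suc r) f rewrite sumUpTo-head r f =
  ℤP.+-assoc (f 0) (sumUpTo r (f ∘ suc)) (f (suc (suc r)))

sumUpTo≡sum : ∀ r (f : ℕ → ℤ) → sumUpTo r f ≡ sum {suc r} (f ∘ toℕ)
sumUpTo≡sum zero    f = sym (ℤP.+-identityʳ (f 0))
sumUpTo≡sum (suc r) f = trans (sumUpTo-head r f) (cong (λ s → f 0 + s) (sumUpTo≡sum r (f ∘ suc)))

sumUpTo-+ : ∀ r (f g : ℕ → ℤ) → sumUpTo r (λ t → f t + g t) ≡ sumUpTo r f + sumUpTo r g
sumUpTo-+ r f g rewrite sumUpTo≡sum r (λ t → f t + g t) | sumUpTo≡sum r f | sumUpTo≡sum r g =
  ∑-distrib-+ {suc r} (f ∘ toℕ) (g ∘ toℕ)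

sumUpTo-*ˡ : ∀ r c (f : ℕ → ℤ) → c * sumUpTo r f ≡ sumUpTo r (λ t → c * f t)
sumUpTo-*ˡ r c f rewrite sumUpTo≡sum r f | sumUpTo≡sum r (λ t → c * f t) =
  *-distribˡ-sum {suc r} c (f ∘ toℕ)

sumUpTo-*ʳ : ∀ r c (f : ℕ → ℤ) → sumUpTo r f * c ≡ sumUpTo r (λ t → f t * c)
sumUpTo-*ʳ r c f = begin
  sumUpTo r f * c            ≡⟨ ℤP.*-comm (sumUpTo r f) c ⟩
  c * sumUpTo r f            ≡⟨ sumUpTo-*ˡ r c f ⟩
  sumUpTo r (λ t → c * f t)  ≡⟨ sumUpTo-cong r (λ t _ → ℤP.*-comm c (f t)) ⟩
  sumUpTo r (λ t → f t * c)  ∎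
  where open ≡-Reasoning

sumUpTo-neg : ∀ r (f : ℕ → ℤ) → - sumUpTo r f ≡ sumUpTo r (λ t → - f t)
sumUpTo-neg r f = begin
  - sumUpTo r f                  ≡⟨ ℤP.-1*i≡-i (sumUpTo r f) ⟨
  - + 1 * sumUpTo r f            ≡⟨ sumUpTo-*ˡ r (- + 1) f ⟩
  sumUpTo r (λ t → - + 1 * f t)  ≡⟨ sumUpTo-cong r (λ t _ → ℤP.-1*i≡-i (f t)) ⟩
  sumUpTo r (λ t → - f t)        ∎
  where open ≡-Reasoning

sumUpTo-difference : ∀ r (f g : ℕ → ℤ) → sumUpTo r (λ t → f t - g t) ≡ sumUpTo r f - sumUpTo r g
sumUpTo-difference r f g =
  trans (sumUpTo-+ r f (λ t → - g t)) (cong (λ s → sumUpTo r f + s) (sym (sumUpTo-neg r g)))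

sumUpTo-comm : ∀ r K (f : ℕ → ℕ → ℤ) →
  sumUpTo r (λ s → sumUpTo K (f s)) ≡ sumUpTo K (λ k → sumUpTo r (λ s → f s k))
sumUpTo-comm r K f = begin
  sumUpTo r (λ s → sumUpTo K (f s))
    ≡⟨ sumUpTo-cong r (λ s _ → sumUpTo≡sum K (f s)) ⟩
  sumUpTo r (λ s → sum {suc K} (f s ∘ toℕ))
    ≡⟨ sumUpTo≡sum r (λ s → sum {suc K} (f s ∘ toℕ)) ⟩
  sum {suc r} (λ s → sum {suc K} (f (toℕ s) ∘ toℕ))
    ≡⟨ ∑-comm {suc r} {suc K} (λ s k → f (toℕ s) (toℕ k)) ⟩
  sum {suc K} (λ k → sum {suc r} (λ s → f (toℕ s) (toℕ k)))
    ≡⟨ sumUpTo≡sum K (λ k → sum {suc r} (λ s → f (toℕ s) k)) ⟨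
  sumUpTo K (λ k → sum {suc r} (λ s → f (toℕ s) k))
    ≡⟨ sumUpTo-cong K (λ k _ → sumUpTo≡sum r (λ s → f s k)) ⟨
  sumUpTo K (λ k → sumUpTo r (λ s → f s k)) ∎
  where open ≡-Reasoning

sumUpTo-interchange : ∀ r K (c : ℕ → ℤ) (w : ℕ → ℕ → ℤ) (v : ℕ → ℤ) →
  sumUpTo r (λ s → sumUpTo K (λ k → c k * w s k) * v s)
  ≡ sumUpTo K (λ k → c k * sumUpTo r (λ s → w s k * v s))
sumUpTo-interchange r K c w v = begin
  sumUpTo r (λ s → sumUpTo K (λ k → c k * w s k) * v s)
    ≡⟨ sumUpTo-cong r (λ s _ → trans (sumUpTo-*ʳ K (v s) (λ k → c k * w s k))
                                     (sumUpTo-cong K (λ k _ → ℤP.*-assoc (c k) (w s k) (v s)))) ⟩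
  sumUpTo r (λ s → sumUpTo K (λ k → c k * (w s k * v s)))
    ≡⟨ sumUpTo-comm r K (λ s k → c k * (w s k * v s)) ⟩
  sumUpTo K (λ k → sumUpTo r (λ s → c k * (w s k * v s)))
    ≡⟨ sumUpTo-cong K (λ k _ → sumUpTo-*ˡ r (c k) (λ s → w s k * v s)) ⟨
  sumUpTo K (λ k → c k * sumUpTo r (λ s → w s k * v s)) ∎
  where open ≡-Reasoning

sumUpTo-zero : ∀ r {f : ℕ → ℤ} → (∀ t → t ≤ r → f t ≡ + 0) → sumUpTo r f ≡ + 0
sumUpTo-zero r f≗0 = trans (sumUpTo-cong r f≗0) (sum-of-zeros r)
  where
  sum-of-zeros : ∀ r → sumUpTo r (λ _ → + 0) ≡ + 0
  sum-of-zeros zero    = refl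
  sum-of-zeros (suc r) = cong (_+ + 0) (sum-of-zeros r)

sumUpTo-reverse : ∀ r (f : ℕ → ℤ) → sumUpTo r (λ t → f (r ∸ t)) ≡ sumUpTo r f
sumUpTo-reverse zero    f = refl
sumUpTo-reverse (suc r) f rewrite sumUpTo-head r (λ t → f (suc r ∸ t)) | sumUpTo-reverse r f =
  ℤP.+-comm (f (suc r)) (sumUpTo r f)

sumUpTo-extend : ∀ {r R} (f : ℕ → ℤ) → r ≤ R → (∀ t → r < t → f t ≡ + 0) →
  sumUpTo R f ≡ sumUpTo r f
sumUpTo-extend {r} f r≤R f≗0 = go (ℕP.≤⇒≤′ r≤R)
  where
  go : ∀ {R} → r ℕ.≤′ R → sumUpTo R f ≡ sumUpTo r f
  go ℕ.≤′-refl            = refl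
  go (ℕ.≤′-step {R} r≤′R) =
    trans (cong₂ _+_ (go r≤′R) (f≗0 (suc R) (s≤s (ℕP.≤′⇒≤ r≤′R)))) (ℤP.+-identityʳ (sumUpTo r f))

sumUpTo-support : ∀ {r R} (f : ℕ → ℤ) →
  (∀ t → r < t → f t ≡ + 0) → (∀ t → R < t → f t ≡ + 0) → sumUpTo r f ≡ sumUpTo R f
sumUpTo-support {r} {R} f f≗0-above-r f≗0-above-R with ℕP.≤-total r R
... | inj₁ r≤R = sym (sumUpTo-extend f r≤R f≗0-above-r)
... | inj₂ R≤r = sumUpTo-extend f R≤r f≗0-above-R

sumUpTo-pick₀ : ∀ r {d} (v : ℕ → ℤ) → d ≤ r → sumUpTo r (λ s → [ s ≐ d ] * v s) ≡ v d
sumUpTo-pick₀ zero    v z≤n = ℤP.*-identityˡ (v 0)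
sumUpTo-pick₀ (suc r) {d} v d≤1+r with d ≟ suc r
... | yes refl = begin
  sumUpTo r (λ s → [ s ≐ suc r ] * v s) + [ suc r ≐ suc r ] * v (suc r)
    ≡⟨ cong₂ _+_ (sumUpTo-zero r (λ s s≤r → off-diagonal (ℕP.<⇒≢ (s≤s s≤r))))
                 (cong (_* v (suc r)) (≐-refl (suc r))) ⟩
  + 0 + + 1 * v (suc r)
    ≡⟨ trans (ℤP.+-identityˡ _) (ℤP.*-identityˡ (v (suc r))) ⟩
  v (suc r) ∎
  where
  open ≡-Reasoning
  off-diagonal : ∀ {s} → s ≢ suc r → [ s ≐ suc r ] * v s ≡ + 0
  off-diagonal {s} s≢1+r = trans (cong (_* v s) (≐-≢ s≢1+r)) (ℤP.*-zeroˡ (v s))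
... | no d≢1+r = begin
  sumUpTo r (λ s → [ s ≐ d ] * v s) + [ suc r ≐ d ] * v (suc r)
    ≡⟨ cong₂ _+_ (sumUpTo-pick₀ r v (ℕP.≤-pred (ℕP.≤∧≢⇒< d≤1+r d≢1+r)))
                 (cong (_* v (suc r)) (≐-≢ (d≢1+r ∘ sym))) ⟩
  v d + + 0 * v (suc r)
    ≡⟨ trans (cong (λ x → v d + x) (ℤP.*-zeroˡ (v (suc r)))) (ℤP.+-identityʳ (v d)) ⟩
  v d ∎
  where open ≡-Reasoning

sumUpTo-pick : ∀ r {a d N} (v : ℕ → ℤ) → d ≤ r → d ℕ.+ a ≡ N →
  sumUpTo r (λ s → [ s ℕ.+ a ≐ N ] * v s) ≡ v d
sumUpTo-pick r {a} {d} {N} v d≤r d+a≡N =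
  trans (sumUpTo-cong r (λ s _ → cong (_* v s) (≐-cong (s+a≡N⇔s≡d {s})))) (sumUpTo-pick₀ r v d≤r)
  where
  s+a≡N⇔s≡d : ∀ {s} → (s ℕ.+ a ≡ N) ⇔ (s ≡ d)
  s+a≡N⇔s≡d {s} = mk⇔ (λ s+a≡N → ℕP.+-cancelʳ-≡ a s d (trans s+a≡N (sym d+a≡N)))
                      (λ s≡d → trans (cong (ℕ._+ a) s≡d) d+a≡N)

sum1to-suc : ∀ K (g : ℕ → ℤ) → sum1to (suc K) g ≡ sumUpTo K (g ∘ suc)
sum1to-suc zero    g = ℤP.+-identityˡ (g 1)
sum1to-suc (suc K) g = cong (_+ g (suc (suc K))) (sum1to-suc K g)

sum1to-shift : ∀ K k (g : ℕ → ℤ) → sum1to (K ℕ.+ suc k) g ≡ sumUpTo (k ℕ.+ K) (g ∘ suc)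
sum1to-shift K k g rewrite ℕP.+-comm K (suc k) = sum1to-suc (k ℕ.+ K) g

-- chebCoeff k j is the coefficient of λ^(k-2j) in the Chebyshev polynomial U_k(λ/2).
chebCoeff : ℕ → ℕ → ℤ
chebCoeff k j = sgn (suc j) * + ((k ∸ j) C j)

pascal-∸ : ∀ k j → (suc k ∸ j) C suc j ≡ (k ∸ j) C j ℕ.+ (k ∸ j) C suc j
pascal-∸ k j with j ≤? k
... | yes j≤k = trans (cong (_C suc j) (ℕP.+-∸-assoc 1 j≤k)) (sym (nCk+nC[k+1]≡[n+1]C[k+1] (k ∸ j) j))
... | no j≰k
  rewrite ℕP.m≤n⇒m∸n≡0 (ℕP.≰⇒> j≰k) | ℕP.m≤n⇒m∸n≡0 (ℕP.<⇒≤ (ℕP.≰⇒> j≰k))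
        | k>n⇒nCk≡0 {0} {j} (ℕP.≤-trans (s≤s z≤n) (ℕP.≰⇒> j≰k)) = refl

chebCoeff-pascal : ∀ k j → chebCoeff (suc (suc k)) (suc j) ≡ chebCoeff (suc k) (suc j) - chebCoeff k j
chebCoeff-pascal k j rewrite pascal-∸ k j | ℤP.pos-+ ((k ∸ j) C j) ((k ∸ j) C suc j) =
  distrib (sgn (suc j)) (+ ((k ∸ j) C j)) (+ ((k ∸ j) C suc j))
  where
  distrib : ∀ σ a b → - σ * (a + b) ≡ - σ * b - σ * a
  distrib = solve-∀

chebCoeff-zero : ∀ {k j} → k < j ℕ.+ j → chebCoeff k j ≡ + 0
chebCoeff-zero {k} {suc j} k<2j =
  trans (cong (λ c → sgn (suc (suc j)) * + c) (k>n⇒nCk≡0 (ℕP.m<n+o⇒m∸n<o k (suc j) k<2j)))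
        (ℤP.*-zeroʳ (sgn (suc (suc j))))

chebCoeff-above : ∀ {k j} → k < j → chebCoeff k j ≡ + 0
chebCoeff-above {k} {j} k<j = chebCoeff-zero {k} {j} (ℕP.≤-trans k<j (ℕP.m≤m+n j j))

chebCoeff-support : ∀ k j → chebCoeff k j ≡ + 0 ⊎ j ℕ.+ j ≤ k
chebCoeff-support k j with j ℕ.+ j ≤? k
... | yes 2j≤k = inj₂ 2j≤k
... | no 2j≰k  = inj₁ (chebCoeff-zero {k} {j} (ℕP.≰⇒> 2j≰k))

chebCoeff-beyond : ∀ {m k t} → m / 4 < t → k ℕ.+ k ≤ m → chebCoeff k t ≡ + 0
chebCoeff-beyond {m} {k} {t} m/4<t 2k≤m =
  chebCoeff-zero {k} {t} (ℕP.*-cancelˡ-< 2 k (t ℕ.+ t) (subst₂ _<_ (double k) (quadruple t) 2k<4t))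
  where
  double : ∀ k → k ℕ.+ k ≡ 2 ℕ.* k
  double = nsolve
  quadruple : ∀ t → t ℕ.* 4 ≡ 2 ℕ.* (t ℕ.+ t)
  quadruple = nsolve
  2k<4t : k ℕ.+ k < t ℕ.* 4
  2k<4t = ℕP.≤-<-trans 2k≤m (ℕP.≰⇒> (λ 4t≤m →
    ℕP.<⇒≱ m/4<t (subst (ℕ._≤ m / 4) (m*n/n≡m t 4) (/-monoˡ-≤ 4 4t≤m))))

module MatrixAction {n : ℕ} (M : Matrix n) where

  V : Set
  V = Fin n → ℤ

  infix 4 _≈_
  _≈_ : V → V → Set
  u ≈ v = ∀ i → u i ≡ v i

  infixl 6 _⊕_ _⊖_
  infixr 7 _·_

  _⊕_ _⊖_ : V → V → V
  (u ⊕ v) i = u i + v i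
  (u ⊖ v) i = u i - v i

  _·_ : ℤ → V → V
  (c · v) i = c * v i

  𝟘 : V
  𝟘 i = + 0

  L : V → V
  L v i = sumFin (λ l → M i l * v l)

  iter : ℕ → V → V
  iter zero    v = v
  iter (suc s) v = L (iter s v)

  poly : (ℕ → ℤ) → ℕ → V → V
  poly c d y i = sumUpTo d (λ s → c s * iter s y i)

  record Linear (F : V → V) : Set where
    field
      F-cong      : ∀ {u v} → u ≈ v → F u ≈ F v
      additive    : ∀ u v → F (u ⊕ v) ≈ F u ⊕ F v
      homogeneous : ∀ c v → F (c · v) ≈ c · F v

  open Linear public

  L-linear : Linear L
  L-linear .F-cong u≈v i = sumFin-cong (λ l → cong (M i l *_) (u≈v l))
  L-linear .additive u v i = trans (sumFin-cong (λ l → ℤP.*-distribˡ-+ (M i l) (u l) (v l)))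
                                   (sumFin-+ (λ l → M i l * u l) (λ l → M i l * v l))
  L-linear .homogeneous c v i = trans (sumFin-cong (λ l → swap (M i l) c (v l)))
                                      (sym (sumFin-*ˡ c (λ l → M i l * v l)))
    where
    swap : ∀ a c x → a * (c * x) ≡ c * (a * x)
    swap = solve-∀

  id-linear : Linear (λ x → x)
  id-linear = record { F-cong = λ u≈v → u≈v ; additive = λ _ _ _ → refl ; homogeneous = λ _ _ _ → refl }

  ∘-linear : ∀ {F G} → Linear F → Linear G → Linear (F ∘ G)
  ∘-linear lf lg .F-cong u≈v = lf .F-cong (lg .F-cong u≈v)
  ∘-linear {G = G} lf lg .additive u v i = trans (lf .F-cong (lg .additive u v) i) (lf .additive (G u) (G v) i)
  ∘-linear {G = G} lf lg .homogeneous c v i = trans (lf .F-cong (lg .homogeneous c v) i) (lf .homogeneous c (G v) i)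

  ⊖-linear : ∀ {F G} → Linear F → Linear G → Linear (λ x → F x ⊖ G x)
  ⊖-linear lf lg .F-cong u≈v i = cong₂ _-_ (lf .F-cong u≈v i) (lg .F-cong u≈v i)
  ⊖-linear {F} {G} lf lg .additive u v i =
    trans (cong₂ _-_ (lf .additive u v i) (lg .additive u v i)) (interchange (F u i) (F v i) (G u i) (G v i))
    where
    interchange : ∀ a b c d → a + b - (c + d) ≡ a - c + (b - d)
    interchange = solve-∀
  ⊖-linear {F} {G} lf lg .homogeneous c v i =
    trans (cong₂ _-_ (lf .homogeneous c v i) (lg .homogeneous c v i)) (distrib c (F v i) (G v i))
    where
    distrib : ∀ c a b → c * a - c * b ≡ c * (a - b)
    distrib = solve-∀

  preserves-𝟘 : ∀ {F} → Linear F → F 𝟘 ≈ 𝟘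
  preserves-𝟘 lf = lf .homogeneous (+ 0) 𝟘

  preserves-⊖ : ∀ {F} → Linear F → ∀ u v → F (u ⊖ v) ≈ F u ⊖ F v
  preserves-⊖ {F} lf u v i = begin
    F (u ⊖ v) i                ≡⟨ lf .F-cong (λ j → as-sum (u j) (v j)) i ⟩
    F (u ⊕ (- + 1) · v) i      ≡⟨ lf .additive u ((- + 1) · v) i ⟩
    F u i + F ((- + 1) · v) i  ≡⟨ cong (λ x → F u i + x) (lf .homogeneous (- + 1) v i) ⟩
    F u i + - + 1 * F v i      ≡⟨ as-sum (F u i) (F v i) ⟨
    F u i - F v i              ∎
    where
    open ≡-Reasoning
    as-sum : ∀ a b → a - b ≡ a + - + 1 * b
    as-sum = solve-∀

  preserves-sumFin : ∀ {F} → Linear F → ∀ {m} (c : Fin m → ℤ) (w : Fin m → V) →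
    F (λ i → sumFin (λ l → c l * w l i)) ≈ (λ i → sumFin (λ l → c l * F (w l) i))
  preserves-sumFin lf {zero}  c w = preserves-𝟘 lf
  preserves-sumFin lf {suc m} c w i =
    trans (lf .additive (c zero · w zero) (λ i → sumFin (λ l → c (suc l) * w (suc l) i)) i)
          (cong₂ _+_ (lf .homogeneous (c zero) (w zero) i) (preserves-sumFin lf (c ∘ suc) (w ∘ suc) i))

  preserves-sumUpTo : ∀ {F} → Linear F → ∀ r (c : ℕ → ℤ) (w : ℕ → V) →
    F (λ i → sumUpTo r (λ j → c j * w j i)) ≈ (λ i → sumUpTo r (λ j → c j * F (w j) i))
  preserves-sumUpTo lf zero    c w = lf .homogeneous (c 0) (w 0)
  preserves-sumUpTo lf (suc r) c w i =
    trans (lf .additive (λ i → sumUpTo r (λ j → c j * w j i)) (c (suc r) · w (suc r)) i)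
          (cong₂ _+_ (preserves-sumUpTo lf r c w i) (lf .homogeneous (c (suc r)) (w (suc r)) i))

  iter-+ : ∀ a b v → iter a (iter b v) ≈ iter (a ℕ.+ b) v
  iter-+ zero    b v i = refl
  iter-+ (suc a) b v   = L-linear .F-cong (iter-+ a b v)

  U : ℕ → V → V
  U zero          x = x
  U (suc zero)    x = L x
  U (suc (suc k)) x = L (U (suc k) x) ⊖ U k x

  U-linear : ∀ k → Linear (U k)
  U-linear zero          = id-linear
  U-linear (suc zero)    = L-linear
  U-linear (suc (suc k)) = ⊖-linear (∘-linear L-linear (U-linear (suc k))) (U-linear k)

  commutes-with-L : (V → V) → Set
  commutes-with-L T = ∀ x → T (L x) ≈ L (T x)

  U-commutes : ∀ k → commutes-with-L (U k)
  U-commutes zero          x i = refl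
  U-commutes (suc zero)    x i = refl
  U-commutes (suc (suc k)) x i =
    trans (cong₂ _-_ (L-linear .F-cong (U-commutes (suc k) x) i) (U-commutes k x i))
          (sym (preserves-⊖ L-linear (L (U (suc k) x)) (U k x) i))

  commutes-with-U : ∀ {T} → Linear T → commutes-with-L T → ∀ k x → T (U k x) ≈ U k (T x)
  commutes-with-U lt TL≈LT zero          x i = refl
  commutes-with-U lt TL≈LT (suc zero)    x   = TL≈LT x
  commutes-with-U lt TL≈LT (suc (suc k)) x i =
    trans (preserves-⊖ lt (L (U (suc k) x)) (U k x) i)
          (cong₂ _-_ (trans (TL≈LT (U (suc k) x) i) (L-linear .F-cong (commutes-with-U lt TL≈LT (suc k) x) i))
                     (commutes-with-U lt TL≈LT k x i))

  chebSum : ℕ → V → V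
  chebSum k x i = sumUpTo k (λ j → chebCoeff k j * iter (k ∸ (j ℕ.+ j)) x i)

  private
    chebSum-term : ∀ k j x i →
      chebCoeff (suc (suc k)) (suc j) * iter (k ∸ (j ℕ.+ j)) x i
      ≡ chebCoeff (suc k) (suc j) * iter (suc (k ∸ (j ℕ.+ suc j))) x i
        - chebCoeff k j * iter (k ∸ (j ℕ.+ j)) x i
    chebSum-term k j x i = begin
      chebCoeff (suc (suc k)) (suc j) * X  ≡⟨ cong (_* X) (chebCoeff-pascal k j) ⟩
      (a - c) * X                          ≡⟨ distrib a c X ⟩
      a * X - c * X                        ≡⟨ cong (_- c * X) aX≡aY ⟩
      a * Y - c * X                        ∎
      where
      open ≡-Reasoning
      a = chebCoeff (suc k) (suc j)
      c = chebCoeff k j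
      X = iter (k ∸ (j ℕ.+ j)) x i
      Y = iter (suc (k ∸ (j ℕ.+ suc j))) x i
      distrib : ∀ a c X → (a - c) * X ≡ a * X - c * X
      distrib = solve-∀
      -- either a vanishes, or the truncated subtractions in the two exponents agree
      aX≡aY : a * X ≡ a * Y
      aX≡aY with chebCoeff-support (suc k) (suc j)
      ... | inj₁ a≡0 rewrite a≡0 = refl
      ... | inj₂ 2j+2≤k+1 = cong (λ e → a * iter e x i)
        (trans (cong (suc k ∸_) (sym (ℕP.+-suc j j))) (ℕP.+-∸-assoc 1 (ℕP.≤-pred 2j+2≤k+1)))

    chebSum-rec : ∀ k x → chebSum (suc (suc k)) x ≈ L (chebSum (suc k) x) ⊖ chebSum k x
    chebSum-rec k x i = begin
      chebSum (suc (suc k)) x i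
        ≡⟨ sumUpTo-head (suc k) _ ⟩
      h + sumUpTo (suc k) (λ j → chebCoeff (suc (suc k)) (suc j) * iter (suc k ∸ (j ℕ.+ suc j)) x i)
        ≡⟨ cong (λ z → h + z) (sumUpTo-cong (suc k) (λ j _ → trans (exponent j) (chebSum-term k j x i))) ⟩
      h + sumUpTo (suc k) (λ j → shifted j - previous j)
        ≡⟨ cong (λ z → h + z) (sumUpTo-difference (suc k) shifted previous) ⟩
      h + (sumUpTo (suc k) shifted - sumUpTo (suc k) previous)
        ≡⟨ cong₂ (λ a b → h + (a - b)) (drop-last shifted (vanishing (ℕP.n<1+n (suc k))))
                                       (drop-last previous (vanishing (ℕP.n<1+n k))) ⟩
      h + (sumUpTo k shifted - chebSum k x i)
        ≡⟨ ℤP.+-assoc h (sumUpTo k shifted) (- chebSum k x i) ⟨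
      h + sumUpTo k shifted - chebSum k x i
        ≡⟨ cong (_- chebSum k x i) (sumUpTo-head k _) ⟨
      sumUpTo (suc k) (λ j → chebCoeff (suc k) j * L (iter (suc k ∸ (j ℕ.+ j)) x) i) - chebSum k x i
        ≡⟨ cong (_- chebSum k x i) (preserves-sumUpTo L-linear (suc k) (chebCoeff (suc k))
                                                       (λ j → iter (suc k ∸ (j ℕ.+ j)) x) i) ⟨
      L (chebSum (suc k) x) i - chebSum k x i ∎
      where
      open ≡-Reasoning
      h = chebCoeff (suc (suc k)) 0 * iter (suc (suc k)) x i
      shifted previous : ℕ → ℤ
      shifted j  = chebCoeff (suc k) (suc j) * iter (suc (k ∸ (j ℕ.+ suc j))) x i
      previous j = chebCoeff k j * iter (k ∸ (j ℕ.+ j)) x i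
      exponent : ∀ j → chebCoeff (suc (suc k)) (suc j) * iter (suc k ∸ (j ℕ.+ suc j)) x i
                     ≡ chebCoeff (suc (suc k)) (suc j) * iter (k ∸ (j ℕ.+ j)) x i
      exponent j = cong (λ e → chebCoeff (suc (suc k)) (suc j) * iter (suc k ∸ e) x i) (ℕP.+-suc j j)
      vanishing : ∀ {k j X} → k < j → chebCoeff k j * X ≡ + 0
      vanishing {X = X} k<j = trans (cong (_* X) (chebCoeff-above k<j)) (ℤP.*-zeroˡ X)
      drop-last : ∀ (f : ℕ → ℤ) → f (suc k) ≡ + 0 → sumUpTo (suc k) f ≡ sumUpTo k f
      drop-last f f[1+k]≡0 = trans (cong (λ z → sumUpTo k f + z) f[1+k]≡0) (ℤP.+-identityʳ (sumUpTo k f))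

  U≈chebSum : ∀ k x → U k x ≈ chebSum k x
  U≈chebSum zero          x i = sym (ℤP.*-identityˡ (x i))
  U≈chebSum (suc zero)    x i = sym (begin
    + 1 * L x i + + 0 * x i  ≡⟨ cong₂ _+_ (ℤP.*-identityˡ (L x i)) (ℤP.*-zeroˡ (x i)) ⟩
    L x i + + 0              ≡⟨ ℤP.+-identityʳ (L x i) ⟩
    L x i                    ∎)
    where open ≡-Reasoning
  U≈chebSum (suc (suc k)) x i =
    trans (cong₂ _-_ (L-linear .F-cong (U≈chebSum (suc k) x) i) (U≈chebSum k x i)) (sym (chebSum-rec k x i))

  chebCoeff-pick : ∀ {r a N} k o b j (y : V) i →
    k ℕ.+ o ≤ r → j ℕ.+ j ℕ.+ b ≡ a → k ℕ.+ o ℕ.+ b ≡ N →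
    chebCoeff k j * sumUpTo r (λ s → [ s ℕ.+ a ≐ N ] * iter s y i)
    ≡ chebCoeff k j * iter (k ∸ (j ℕ.+ j)) (iter o y) i
  chebCoeff-pick {r} {a} {N} k o b j y i k+o≤r 2j+b≡a k+o+b≡N with chebCoeff-support k j
  ... | inj₁ c≡0  rewrite c≡0 = refl
  ... | inj₂ 2j≤k =
    cong (chebCoeff k j *_) (trans (sumUpTo-pick r (λ s → iter s y i) e+o≤r e+o+a≡N) (sym (iter-+ e o y i)))
    where
    e = k ∸ (j ℕ.+ j)
    e+o≤r : e ℕ.+ o ≤ r
    e+o≤r = ℕP.≤-trans (ℕP.+-monoˡ-≤ o (ℕP.m∸n≤m k (j ℕ.+ j))) k+o≤r
    regroup : ∀ e o j b → e ℕ.+ o ℕ.+ (j ℕ.+ j ℕ.+ b) ≡ e ℕ.+ (j ℕ.+ j) ℕ.+ o ℕ.+ b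
    regroup = nsolve
    e+o+a≡N : e ℕ.+ o ℕ.+ a ≡ N
    e+o+a≡N = begin
      e ℕ.+ o ℕ.+ a                ≡⟨ cong (e ℕ.+ o ℕ.+_) 2j+b≡a ⟨
      e ℕ.+ o ℕ.+ (j ℕ.+ j ℕ.+ b)  ≡⟨ regroup e o j b ⟩
      e ℕ.+ (j ℕ.+ j) ℕ.+ o ℕ.+ b  ≡⟨ cong (λ x → x ℕ.+ o ℕ.+ b) (ℕP.m∸n+n≡m 2j≤k) ⟩
      k ℕ.+ o ℕ.+ b                ≡⟨ k+o+b≡N ⟩
      N                            ∎
      where open ≡-Reasoning

  collect-U : ∀ {r N} k o b K (a : ℕ → ℕ) (c : ℕ → ℤ) (y : V) i →
    k ℕ.+ o ≤ r → k ℕ.+ o ℕ.+ b ≡ N → (∀ j → j ℕ.+ j ℕ.+ b ≡ a j) →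
    (∀ j → c j ≡ chebCoeff k j) → (∀ t → K < t → chebCoeff k t ≡ + 0) →
    sumUpTo K (λ j → c j * sumUpTo r (λ s → [ s ℕ.+ a j ≐ N ] * iter s y i)) ≡ U k (iter o y) i
  collect-U {r} {N} k o b K a c y i k+o≤r k+o+b≡N 2j+b≡a c≗chebCoeff chebCoeff-above-K = begin
    sumUpTo K (λ j → c j * sumUpTo r (λ s → [ s ℕ.+ a j ≐ N ] * iter s y i))
      ≡⟨ sumUpTo-cong K (λ j _ → trans (cong (_* _) (c≗chebCoeff j))
                                       (chebCoeff-pick k o b j y i k+o≤r (2j+b≡a j) k+o+b≡N)) ⟩
    sumUpTo K term
      ≡⟨ sumUpTo-support term (λ t K<t → vanishing t (chebCoeff-above-K t K<t))
                              (λ t k<t → vanishing t (chebCoeff-above {k} {t} k<t)) ⟩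
    chebSum k (iter o y) i
      ≡⟨ U≈chebSum k (iter o y) i ⟨
    U k (iter o y) i ∎
    where
    open ≡-Reasoning
    term : ℕ → ℤ
    term j = chebCoeff k j * iter (k ∸ (j ℕ.+ j)) (iter o y) i
    vanishing : ∀ t → chebCoeff k t ≡ + 0 → term t ≡ + 0
    vanishing t c≡0 = trans (cong (_* X) c≡0) (ℤP.*-zeroˡ X)
      where X = iter (k ∸ (t ℕ.+ t)) (iter o y) i

  ^^-column : ∀ s a j → (λ i → (M ^^ (s ℕ.+ a)) i j) ≈ iter s (λ l → (M ^^ a) l j)
  ^^-column zero    a j i = refl
  ^^-column (suc s) a j i = sumFin-cong (λ l → cong (M i l *_) (^^-column s a j l))

  recurrence : ∀ (c : ℕ → ℤ) d → (∀ y → poly c d y ≈ 𝟘) →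
    ∀ i j m → d ≤ m → sumUpTo d (λ t → c (d ∸ t) * (M ^^ (m ∸ t)) i j) ≡ + 0
  recurrence c d poly≈𝟘 i j m d≤m = begin
    sumUpTo d (λ t → c (d ∸ t) * (M ^^ (m ∸ t)) i j)
      ≡⟨ sumUpTo-cong d (λ t t≤d → cong (λ e → c (d ∸ t) * (M ^^ e) i j) (exponent t≤d)) ⟩
    sumUpTo d (λ t → c (d ∸ t) * (M ^^ ((d ∸ t) ℕ.+ (m ∸ d))) i j)
      ≡⟨ sumUpTo-reverse d (λ s → c s * (M ^^ (s ℕ.+ (m ∸ d))) i j) ⟩
    sumUpTo d (λ s → c s * (M ^^ (s ℕ.+ (m ∸ d))) i j)
      ≡⟨ sumUpTo-cong d (λ s _ → cong (c s *_) (^^-column s (m ∸ d) j i)) ⟩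
    poly c d (λ l → (M ^^ (m ∸ d)) l j) i
      ≡⟨ poly≈𝟘 (λ l → (M ^^ (m ∸ d)) l j) i ⟩
    + 0 ∎
    where
    open ≡-Reasoning
    exponent : ∀ {t} → t ≤ d → m ∸ t ≡ (d ∸ t) ℕ.+ (m ∸ d)
    exponent {t} t≤d = sym (begin
      (d ∸ t) ℕ.+ (m ∸ d)  ≡⟨ ℕP.+-comm (d ∸ t) (m ∸ d) ⟩
      (m ∸ d) ℕ.+ (d ∸ t)  ≡⟨ ℕP.+-∸-assoc (m ∸ d) t≤d ⟨
      (m ∸ d) ℕ.+ d ∸ t    ≡⟨ cong (_∸ t) (ℕP.m∸n+n≡m d≤m) ⟩
      m ∸ t                ∎)

-- The columns of A

module Columns (n : ℕ) where
  open MatrixAction (A n)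

  column : ℕ → V
  column k i = 𝟙 (⌊ k ≟ suc (toℕ i) ⌋ ∨ ⌊ toℕ i ℕ.+ k ℕ.+ 2 ≟ suc n ⌋)

  unit : ℕ → V
  unit k i = [ toℕ i ≐ k ]

  L-unit : ∀ {k} → k < n → L (unit k) ≈ column k
  L-unit k<n i = sumFin-pick (λ l → column l i) k<n

  L-by-columns : ∀ y → L y ≈ λ i → sumFin (λ l → y l * column (toℕ l) i)
  L-by-columns y i = sumFin-cong (λ l → ℤP.*-comm (A n i l) (y l))

  private
    regroup : ∀ k q → k ℕ.+ q ℕ.+ 2 ≡ suc k ℕ.+ suc q
    regroup = nsolve

    antidiagonal⇔ : ∀ {t k q} → n ≡ k ℕ.+ q → (t ℕ.+ k ℕ.+ 2 ≡ suc n) ⇔ (q ≡ suc t)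
    antidiagonal⇔ {t} {k} {q} n≡k+q = mk⇔
      (λ e → sym (ℕP.+-cancelʳ-≡ (suc k) (suc t) q (trans (sym (regroup t k)) (trans e 1+n≡q+1+k))))
      (λ e → trans (regroup t k) (trans (cong (ℕ._+ suc k) (sym e)) (sym 1+n≡q+1+k)))
      where
      1+n≡q+1+k : suc n ≡ q ℕ.+ suc k
      1+n≡q+1+k = trans (cong suc n≡k+q) (sym (trans (ℕP.+-suc q k) (cong suc (ℕP.+-comm q k))))

    suc≡suc⇔ : ∀ {a b} → (suc a ≡ suc b) ⇔ (b ≡ a)
    suc≡suc⇔ = mk⇔ (sym ∘ ℕP.suc-injective) (cong suc ∘ sym)

  column-sym : ∀ {k q} → n ≡ k ℕ.+ q → column k ≈ column q
  column-sym {k} {q} n≡k+q i = cong 𝟙 (begin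
    ⌊ k ≟ suc t ⌋ ∨ ⌊ t ℕ.+ k ℕ.+ 2 ≟ suc n ⌋
      ≡⟨ cong₂ _∨_ (sym (≟-cong (antidiagonal⇔ {t} {q} (trans n≡k+q (ℕP.+-comm k q)))))
                   (≟-cong (antidiagonal⇔ {t} {k} n≡k+q)) ⟩
    ⌊ t ℕ.+ q ℕ.+ 2 ≟ suc n ⌋ ∨ ⌊ q ≟ suc t ⌋
      ≡⟨ ∨-comm ⌊ t ℕ.+ q ℕ.+ 2 ≟ suc n ⌋ ⌊ q ≟ suc t ⌋ ⟩
    ⌊ q ≟ suc t ⌋ ∨ ⌊ t ℕ.+ q ℕ.+ 2 ≟ suc n ⌋ ∎)
    where
    open ≡-Reasoning
    t = toℕ i

  column₀≈unit : ∀ {q} → n ≡ suc q → column 0 ≈ unit q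
  column₀≈unit {q} n≡1+q i =
    cong 𝟙 (≟-cong (⇔.trans (antidiagonal⇔ {toℕ i} {0} n≡1+q) (suc≡suc⇔ {q} {toℕ i})))

  column-suc : ∀ {k q} → n ≡ k ℕ.+ q ℕ.+ 2 → ∀ i →
    column (suc k) i ≡ 𝟙 (⌊ toℕ i ≟ k ⌋ ∨ ⌊ toℕ i ≟ q ⌋)
  column-suc {k} {q} n≡k+q+2 i =
    cong 𝟙 (cong₂ _∨_ (≟-cong (suc≡suc⇔ {k} {t}))
                      (≟-cong (⇔.trans (antidiagonal⇔ {t} {suc k} (trans n≡k+q+2 (regroup k q)))
                                       (suc≡suc⇔ {q} {t}))))
    where t = toℕ i

  column-mid : ∀ {k} → n ≡ k ℕ.+ k ℕ.+ 2 → column (suc k) ≈ unit k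
  column-mid n≡2k+2 i = trans (column-suc n≡2k+2 i) (cong 𝟙 (∨-idem _))

  column-split : ∀ {k q} → n ≡ k ℕ.+ q ℕ.+ 2 → k ≢ q → column (suc k) ≈ unit k ⊕ unit q
  column-split n≡k+q+2 k≢q i = trans (column-suc n≡k+q+2 i) (𝟙-∨-≟ (toℕ i) k≢q)

  L-column-mid : ∀ {k} → n ≡ k ℕ.+ k ℕ.+ 2 → L (column (suc k)) ≈ column k
  L-column-mid {k} n≡2k+2 i =
    trans (L-linear .F-cong (column-mid n≡2k+2) i)
          (L-unit (subst (k <_) (sym (trans n≡2k+2 (regroup k k))) (ℕP.m≤m+n (suc k) (suc k))) i)

  L-column-split : ∀ {k q} → n ≡ k ℕ.+ q ℕ.+ 2 → k ≢ q →
    L (column (suc k)) ≈ column k ⊕ column (suc (suc k))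
  L-column-split {k} {q} n≡k+q+2 k≢q i =
    trans (L-linear .F-cong (column-split n≡k+q+2 k≢q) i)
          (trans (L-linear .additive (unit k) (unit q) i)
                 (cong₂ _+_ (L-unit k<n i) (trans (L-unit q<n i) (column-sym n≡q+2+k i))))
    where
    n≡1+k+1+q : n ≡ suc k ℕ.+ suc q
    n≡1+k+1+q = trans n≡k+q+2 (regroup k q)
    n≡q+2+k : n ≡ q ℕ.+ suc (suc k)
    n≡q+2+k = trans n≡1+k+1+q (trans (ℕP.+-comm (suc k) (suc q)) (sym (ℕP.+-suc q (suc k))))
    k<n : k < n
    k<n = subst (k <_) (sym n≡1+k+1+q) (ℕP.m≤m+n (suc k) (suc q))
    q<n : q < n
    q<n = subst (q <_) (sym n≡1+k+1+q) (ℕP.m≤n+m (suc q) (suc k))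

  U-column₀ : ∀ {q} → n ≡ suc (suc q) → ∀ j → j ℕ.+ j ≤ n → U j (column 0) ≈ column j
  U-column₀ n≡2+q zero _ i = refl
  U-column₀ {q} n≡2+q (suc zero) _ i =
    trans (L-linear .F-cong (column₀≈unit n≡2+q) i)
          (trans (L-unit (ℕP.≤-reflexive (sym n≡2+q)) i)
                 (column-sym (trans n≡2+q (cong suc (ℕP.+-comm 1 q))) i))
  U-column₀ n≡2+q (suc (suc j)) 2j+4≤n i =
    trans (cong₂ _-_ (trans (L-linear .F-cong (U-column₀ n≡2+q (suc j) 2j+2≤n) i)
                            (L-column-split n≡j+q+2 j≢q i))
                     (U-column₀ n≡2+q j 2j≤n i))
          (cancel (column j i) (column (suc (suc j)) i))
    where
    cancel : ∀ a b → a + b - a ≡ b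
    cancel = solve-∀
    r = n ∸ (suc (suc j) ℕ.+ suc (suc j))
    q = suc (suc j) ℕ.+ r
    n≡j+q+2 : n ≡ j ℕ.+ q ℕ.+ 2
    n≡j+q+2 = trans (sym (ℕP.m+[n∸m]≡n 2j+4≤n)) (regroup′ j r)
      where
      regroup′ : ∀ j r → suc (suc j) ℕ.+ suc (suc j) ℕ.+ r ≡ j ℕ.+ (suc (suc j) ℕ.+ r) ℕ.+ 2
      regroup′ = nsolve
    j≢q : j ≢ q
    j≢q j≡q = ℕP.<-irrefl j≡q (ℕP.≤-trans (ℕP.n≤1+n (suc j)) (ℕP.m≤m+n (suc (suc j)) r))
    2j+2≤n : suc j ℕ.+ suc j ≤ n
    2j+2≤n = ℕP.≤-trans (ℕP.+-mono-≤ (ℕP.n≤1+n (suc j)) (ℕP.n≤1+n (suc j))) 2j+4≤n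
    2j≤n : j ℕ.+ j ≤ n
    2j≤n = ℕP.≤-trans (ℕP.+-mono-≤ (ℕP.n≤1+n j) (ℕP.n≤1+n j)) 2j+2≤n

  column-cyclic : ∀ {q} → n ≡ suc (suc q) → ∀ {k} → k < n → Σ[ m ∈ ℕ ] column k ≈ U m (column 0)
  column-cyclic n≡2+q {k} k<n with k ℕ.+ k ≤? n
  ... | yes 2k≤n = k , λ i → sym (U-column₀ n≡2+q k 2k≤n i)
  ... | no 2k≰n  = m , λ i → trans (column-sym n≡k+m i) (sym (U-column₀ n≡2+q m 2m≤n i))
    where
    m = n ∸ k
    n≡k+m : n ≡ k ℕ.+ m
    n≡k+m = sym (ℕP.m+[n∸m]≡n (ℕP.<⇒≤ k<n))
    m<k : m < k
    m<k = ℕP.+-cancelˡ-< k m k (subst (_< k ℕ.+ k) n≡k+m (ℕP.≰⇒> 2k≰n))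
    2m≤n : m ℕ.+ m ≤ n
    2m≤n = subst (m ℕ.+ m ≤_) (trans (ℕP.+-comm m k) (sym n≡k+m)) (ℕP.+-monoʳ-≤ m (ℕP.<⇒≤ m<k))

  kills-image-of-L : ∀ {q T} → n ≡ suc (suc q) → Linear T → commutes-with-L T → T (column 0) ≈ 𝟘 →
    ∀ y → T (L y) ≈ 𝟘
  kills-image-of-L {T = T} n≡2+q lt TL≈LT Tc₀≈𝟘 y i = begin
    T (L y) i                                           ≡⟨ lt .F-cong (L-by-columns y) i ⟩
    T (λ i → sumFin (λ l → y l * column (toℕ l) i)) i  ≡⟨ preserves-sumFin lt y (column ∘ toℕ) i ⟩
    sumFin (λ l → y l * T (column (toℕ l)) i)           ≡⟨ sumFin-zero (λ l → kill-term l) ⟩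
    + 0                                                 ∎
    where
    open ≡-Reasoning
    T-column : ∀ {k} → k < n → T (column k) ≈ 𝟘
    T-column k<n i with column-cyclic n≡2+q k<n
    ... | m , cₖ≈Uc₀ = begin
      T (column _) i        ≡⟨ lt .F-cong cₖ≈Uc₀ i ⟩
      T (U m (column 0)) i  ≡⟨ commutes-with-U lt TL≈LT m (column 0) i ⟩
      U m (T (column 0)) i  ≡⟨ U-linear m .F-cong Tc₀≈𝟘 i ⟩
      U m 𝟘 i               ≡⟨ preserves-𝟘 (U-linear m) i ⟩
      + 0                   ∎
    kill-term : ∀ l → y l * T (column (toℕ l)) i ≡ + 0
    kill-term l = trans (cong (y l *_) (T-column (toℕ<n l) i)) (ℤP.*-zeroʳ (y l))

-- The polynomial P_n as a Chebyshev operator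

coeffP-even : ∀ {n} e → even? n ≡ true → coeffP n e ≡
  sum1to ((n ℕ.+ 2) / 4 ℕ.+ 1) (λ k →
    sgn k * + ((n / 2 ℕ.+ 2 ∸ k) C (k ∸ 1)) * [ e ℕ.+ 2 ℕ.* k ≐ n ℕ.+ 2 ])
coeffP-even {n} e _ with even? n
... | true = refl

coeffP-odd : ∀ {n} e → even? n ≡ false → coeffP n e ≡
  sum1to ((n ℕ.+ 2) / 4 ℕ.+ 2) (λ k →
    sgn k * (+ (((n ℕ.+ 3) / 2 ∸ k) C (k ∸ 1)) * [ e ℕ.+ 2 ℕ.* k ≐ n ℕ.+ 2 ]
             + binomLowerMinus2 ((n ℕ.+ 3) / 2 ∸ k) k * [ e ℕ.+ 2 ℕ.* k ≐ n ℕ.+ 3 ]))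
coeffP-odd {n} e _ with even? n
... | false = refl

even?-double : ∀ h → even? (h ℕ.+ h) ≡ true
even?-double zero    = refl
even?-double (suc h) rewrite ℕP.+-suc h h = even?-double h

even?-suc-double : ∀ h → even? (suc (h ℕ.+ h)) ≡ false
even?-suc-double zero    = refl
even?-suc-double (suc h) rewrite ℕP.+-suc h h = even?-suc-double h

module EvenCase (h′ : ℕ) where
  h n : ℕ
  h = suc h′
  n = h ℕ.+ h
  open MatrixAction (A n)
  open Columns n

  private
    K = (n ℕ.+ 2) / 4

    n≡2+2h′ : n ≡ suc (suc (h′ ℕ.+ h′))
    n≡2+2h′ = cong suc (ℕP.+-suc h′ h′)

    n/2≡h : n / 2 ≡ h
    n/2≡h = trans (cong (_/ 2) (double h)) (m*n/n≡m h 2)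
      where
      double : ∀ h → h ℕ.+ h ≡ h ℕ.* 2
      double = nsolve

  P≈U : ∀ y → poly (coeffP n) n y ≈ U (suc h) (iter h′ y)
  P≈U y i = begin
    sumUpTo n (λ s → coeffP n s * iter s y i)
      ≡⟨ sumUpTo-cong n (λ s _ → cong (_* iter s y i)
           (trans (coeffP-even {n} s (even?-double h)) (sum1to-shift K 0 (λ k → c k * I s k)))) ⟩
    sumUpTo n (λ s → sumUpTo K (λ j → c (suc j) * I s (suc j)) * iter s y i)
      ≡⟨ sumUpTo-interchange n K (c ∘ suc) (λ s j → I s (suc j)) (λ s → iter s y i) ⟩
    sumUpTo K (λ j → c (suc j) * sumUpTo n (λ s → I s (suc j) * iter s y i))
      ≡⟨ collect-U (suc h) h′ 2 K (λ j → 2 ℕ.* suc j) (c ∘ suc) y i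
           (ℕP.≤-reflexive (sym n≡2+2h′)) (regroup₁ h′) regroup₂ c≗chebCoeff
           (λ t K<t → chebCoeff-beyond K<t (ℕP.≤-reflexive (regroup₃ h′))) ⟩
    U (suc h) (iter h′ y) i ∎
    where
    open ≡-Reasoning
    c : ℕ → ℤ
    c k = sgn k * + ((n / 2 ℕ.+ 2 ∸ k) C (k ∸ 1))
    I : ℕ → ℕ → ℤ
    I s k = [ s ℕ.+ 2 ℕ.* k ≐ n ℕ.+ 2 ]
    c≗chebCoeff : ∀ j → c (suc j) ≡ chebCoeff (suc h) j
    c≗chebCoeff j =
      cong (λ m → sgn (suc j) * + ((m ∸ suc j) C j)) (trans (cong (ℕ._+ 2) n/2≡h) (ℕP.+-comm h 2))
    regroup₁ : ∀ h′ → suc (suc h′) ℕ.+ h′ ℕ.+ 2 ≡ suc h′ ℕ.+ suc h′ ℕ.+ 2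
    regroup₁ = nsolve
    regroup₂ : ∀ j → j ℕ.+ j ℕ.+ 2 ≡ 2 ℕ.* suc j
    regroup₂ = nsolve
    regroup₃ : ∀ h′ → suc (suc h′) ℕ.+ suc (suc h′) ≡ suc h′ ℕ.+ suc h′ ℕ.+ 2
    regroup₃ = nsolve

  U-kills-column₀ : U (suc h) (column 0) ≈ 𝟘
  U-kills-column₀ i =
    trans (cong₂ _-_ (trans (L-linear .F-cong (U-column₀ n≡2+2h′ h ℕP.≤-refl) i)
                            (L-column-mid (trans n≡2+2h′ (regroup h′)) i))
                     (U-column₀ n≡2+2h′ h′ 2h′≤n i))
          (ℤP.+-inverseʳ (column h′ i))
    where
    regroup : ∀ h′ → suc (suc (h′ ℕ.+ h′)) ≡ h′ ℕ.+ h′ ℕ.+ 2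
    regroup = nsolve
    2h′≤n : h′ ℕ.+ h′ ≤ n
    2h′≤n = ℕP.+-mono-≤ (ℕP.n≤1+n h′) (ℕP.n≤1+n h′)

  P-annihilates : ∀ y z → iter h′ y ≈ L z → poly (coeffP n) n y ≈ 𝟘
  P-annihilates y z h′-power≈Lz i =
    trans (P≈U y i)
          (trans (U-linear (suc h) .F-cong h′-power≈Lz i)
                 (kills-image-of-L n≡2+2h′ (U-linear (suc h)) (U-commutes (suc h)) U-kills-column₀ z i))

module OddCase (h′ : ℕ) where
  h n : ℕ
  h = suc h′
  n = suc (h ℕ.+ h)
  open MatrixAction (A n)
  open Columns n

  T : V → V
  T x = U (suc h) x ⊖ U h x

  T-linear : Linear T
  T-linear = ⊖-linear (U-linear (suc h)) (U-linear h)

  T-commutes : commutes-with-L T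
  T-commutes x i = trans (cong₂ _-_ (U-commutes (suc h) x i) (U-commutes h x i))
                         (sym (preserves-⊖ L-linear (U (suc h) x) (U h x) i))

  private
    K = (n ℕ.+ 2) / 4

    [n+3]/2≡2+h : (n ℕ.+ 3) / 2 ≡ suc (suc h)
    [n+3]/2≡2+h = trans (cong (_/ 2) (regroup h)) (m*n/n≡m (suc (suc h)) 2)
      where
      regroup : ∀ h → suc (h ℕ.+ h) ℕ.+ 3 ≡ suc (suc h) ℕ.* 2
      regroup = nsolve

    c₁ c₂ : ℕ → ℤ
    c₁ k = sgn k * + (((n ℕ.+ 3) / 2 ∸ k) C (k ∸ 1))
    c₂ k = sgn k * binomLowerMinus2 ((n ℕ.+ 3) / 2 ∸ k) k

    I₂ I₃ : ℕ → ℕ → ℤ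
    I₂ s k = [ s ℕ.+ 2 ℕ.* k ≐ n ℕ.+ 2 ]
    I₃ s k = [ s ℕ.+ 2 ℕ.* k ≐ n ℕ.+ 3 ]

    P₂ P₃ : ℕ → ℤ
    P₂ s = sumUpTo (suc K) (λ j → c₁ (suc j) * I₂ s (suc j))
    P₃ s = sumUpTo (suc K) (λ j → c₂ (suc j) * I₃ s (suc j))

    coeffP-split : ∀ s → coeffP n s ≡ P₂ s + P₃ s
    coeffP-split s = begin
      coeffP n s
        ≡⟨ coeffP-odd {n} s (even?-suc-double h) ⟩
      sum1to (K ℕ.+ 2) (λ k → sgn k * (X k * I₂ s k + Y k * I₃ s k))
        ≡⟨ sum1to-shift K 1 (λ k → sgn k * (X k * I₂ s k + Y k * I₃ s k)) ⟩
      sumUpTo (suc K) (λ j → sgn (suc j) * (X (suc j) * I₂ s (suc j) + Y (suc j) * I₃ s (suc j)))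
        ≡⟨ sumUpTo-cong (suc K) (λ j _ →
             distrib (sgn (suc j)) (X (suc j)) (Y (suc j)) (I₂ s (suc j)) (I₃ s (suc j))) ⟩
      sumUpTo (suc K) (λ j → c₁ (suc j) * I₂ s (suc j) + c₂ (suc j) * I₃ s (suc j))
        ≡⟨ sumUpTo-+ (suc K) (λ j → c₁ (suc j) * I₂ s (suc j)) (λ j → c₂ (suc j) * I₃ s (suc j)) ⟩
      P₂ s + P₃ s ∎
      where
      open ≡-Reasoning
      X Y : ℕ → ℤ
      X k = + (((n ℕ.+ 3) / 2 ∸ k) C (k ∸ 1))
      Y k = binomLowerMinus2 ((n ℕ.+ 3) / 2 ∸ k) k
      distrib : ∀ σ x y a b → σ * (x * a + y * b) ≡ σ * x * a + σ * y * b
      distrib = solve-∀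

    chebCoeff-above-K : ∀ {k} → k ℕ.+ k ≤ n ℕ.+ 2 → ∀ t → K < t → chebCoeff k t ≡ + 0
    chebCoeff-above-K 2k≤n+2 t K<t = chebCoeff-beyond K<t 2k≤n+2

  P≈T : ∀ y → poly (coeffP n) n y ≈ T (iter h y)
  P≈T y i = begin
    sumUpTo n (λ s → coeffP n s * v s)
      ≡⟨ sumUpTo-cong n (λ s _ → trans (cong (_* v s) (coeffP-split s))
                                       (ℤP.*-distribʳ-+ (v s) (P₂ s) (P₃ s))) ⟩
    sumUpTo n (λ s → P₂ s * v s + P₃ s * v s)
      ≡⟨ sumUpTo-+ n (λ s → P₂ s * v s) (λ s → P₃ s * v s) ⟩
    sumUpTo n (λ s → P₂ s * v s) + sumUpTo n (λ s → P₃ s * v s)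
      ≡⟨ cong₂ _+_ (sumUpTo-interchange n (suc K) (c₁ ∘ suc) (λ s j → I₂ s (suc j)) v)
                   (sumUpTo-interchange n (suc K) (c₂ ∘ suc) (λ s j → I₃ s (suc j)) v) ⟩
    sumUpTo (suc K) (λ j → c₁ (suc j) * S₂ (suc j)) + sumUpTo (suc K) (λ j → c₂ (suc j) * S₃ (suc j))
      ≡⟨ cong₂ _+_ leading trailing ⟩
    U (suc h) (iter h y) i - U h (iter h y) i ∎
    where
    open ≡-Reasoning
    v : ℕ → ℤ
    v s = iter s y i
    S₂ S₃ : ℕ → ℤ
    S₂ k = sumUpTo n (λ s → I₂ s k * v s)
    S₃ k = sumUpTo n (λ s → I₃ s k * v s)

    leading : sumUpTo (suc K) (λ j → c₁ (suc j) * S₂ (suc j)) ≡ U (suc h) (iter h y) i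
    leading = collect-U (suc h) h 2 (suc K) (λ j → 2 ℕ.* suc j) (c₁ ∘ suc) y i
      ℕP.≤-refl (regroup₁ h) regroup₂
      (λ j → cong (λ m → sgn (suc j) * + ((m ∸ suc j) C j)) [n+3]/2≡2+h)
      (λ t 1+K<t → chebCoeff-above-K 2h+2≤n+2 t (ℕP.<-trans (ℕP.n<1+n K) 1+K<t))
      where
      regroup₁ : ∀ h → suc h ℕ.+ h ℕ.+ 2 ≡ suc (h ℕ.+ h) ℕ.+ 2
      regroup₁ = nsolve
      regroup₂ : ∀ j → j ℕ.+ j ℕ.+ 2 ≡ 2 ℕ.* suc j
      regroup₂ = nsolve
      regroup₃ : ∀ h → suc h ℕ.+ suc h ≡ h ℕ.+ h ℕ.+ 2
      regroup₃ = nsolve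
      2h+2≤n+2 : suc h ℕ.+ suc h ≤ n ℕ.+ 2
      2h+2≤n+2 = ℕP.≤-trans (ℕP.≤-reflexive (regroup₃ h)) (ℕP.+-monoˡ-≤ 2 (ℕP.n≤1+n (h ℕ.+ h)))

    trailing : sumUpTo (suc K) (λ j → c₂ (suc j) * S₃ (suc j)) ≡ - U h (iter h y) i
    trailing = begin
      sumUpTo (suc K) (λ j → c₂ (suc j) * S₃ (suc j))
        ≡⟨ sumUpTo-head K (λ j → c₂ (suc j) * S₃ (suc j)) ⟩
      + 0 + sumUpTo K (λ j → c₂ (suc (suc j)) * S₃ (suc (suc j)))
        ≡⟨ ℤP.+-identityˡ _ ⟩
      sumUpTo K (λ j → c₂ (suc (suc j)) * S₃ (suc (suc j)))
        ≡⟨ sumUpTo-cong K (λ j _ → double-neg (c₂ (suc (suc j))) (S₃ (suc (suc j)))) ⟩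
      sumUpTo K (λ j → - (- c₂ (suc (suc j)) * S₃ (suc (suc j))))
        ≡⟨ sumUpTo-neg K (λ j → - c₂ (suc (suc j)) * S₃ (suc (suc j))) ⟨
      - sumUpTo K (λ j → - c₂ (suc (suc j)) * S₃ (suc (suc j)))
        ≡⟨ cong -_ (collect-U h h 4 K (λ j → 2 ℕ.* suc (suc j)) (λ j → - c₂ (suc (suc j))) y i
                      (ℕP.n≤1+n (h ℕ.+ h)) (regroup₁ h) regroup₂ -c₂≗chebCoeff
                      (chebCoeff-above-K 2h≤n+2)) ⟩
      - U h (iter h y) i ∎
      where
      double-neg : ∀ a b → a * b ≡ - (- a * b)
      double-neg = solve-∀
      regroup₁ : ∀ h → h ℕ.+ h ℕ.+ 4 ≡ suc (h ℕ.+ h) ℕ.+ 3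
      regroup₁ = nsolve
      regroup₂ : ∀ j → j ℕ.+ j ℕ.+ 4 ≡ 2 ℕ.* suc (suc j)
      regroup₂ = nsolve
      -c₂≗chebCoeff : ∀ j → - c₂ (suc (suc j)) ≡ chebCoeff h j
      -c₂≗chebCoeff j rewrite [n+3]/2≡2+h = flip-sign (sgn (suc j)) (+ ((h ∸ j) C j))
        where
        flip-sign : ∀ σ c → - (- σ * c) ≡ σ * c
        flip-sign = solve-∀
      2h≤n+2 : h ℕ.+ h ≤ n ℕ.+ 2
      2h≤n+2 = ℕP.≤-trans (ℕP.n≤1+n (h ℕ.+ h)) (ℕP.m≤m+n n 2)

  T-kills-column₀ : T (column 0) ≈ 𝟘
  T-kills-column₀ i =
    trans (cong₂ _-_ (cong₂ _-_ (trans (L-linear .F-cong (U-column₀ refl h 2h≤n) i)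
                                       (trans (L-column-split (regroup h′) h′≢h i)
                                              (cong (λ x → column h′ i + x) (column-sym {suc h} {h} refl i))))
                                (U-column₀ refl h′ 2h′≤n i))
                     (U-column₀ refl h 2h≤n i))
          (cancel (column h′ i) (column h i))
    where
    regroup : ∀ h′ → suc (suc (h′ ℕ.+ suc h′)) ≡ h′ ℕ.+ suc h′ ℕ.+ 2
    regroup = nsolve
    cancel : ∀ a b → a + b - a - b ≡ + 0
    cancel = solve-∀
    h′≢h : h′ ≢ h
    h′≢h h′≡h = ℕP.<-irrefl h′≡h (ℕP.n<1+n h′)
    2h≤n : h ℕ.+ h ≤ n
    2h≤n = ℕP.n≤1+n (h ℕ.+ h)
    2h′≤n : h′ ℕ.+ h′ ≤ n
    2h′≤n = ℕP.≤-trans (ℕP.+-mono-≤ (ℕP.n≤1+n h′) (ℕP.n≤1+n h′)) 2h≤n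

  P-annihilates : ∀ y → poly (coeffP n) n y ≈ 𝟘
  P-annihilates y i = trans (P≈T y i) (kills-image-of-L refl T-linear T-commutes T-kills-column₀ (iter h′ y) i)

module _ where
  open MatrixAction (A 2)

  L²≈id : ∀ y → L (L y) ≈ y
  L²≈id y zero       = normalise (L y zero) (y zero) (y (suc zero))
    where
    normalise : ∀ X a b → + 0 * X + (+ 1 * (+ 1 * a + (+ 0 * b + + 0)) + + 0) ≡ a
    normalise = solve-∀
  L²≈id y (suc zero) = normalise (L y (suc zero)) (y zero) (y (suc zero))
    where
    normalise : ∀ X a b → + 1 * (+ 0 * a + (+ 1 * b + + 0)) + (+ 0 * X + + 0) ≡ b
    normalise = solve-∀

halve : ∀ n → Σ[ h ∈ ℕ ] (n ≡ h ℕ.+ h ⊎ n ≡ suc (h ℕ.+ h))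
halve zero = 0 , inj₁ refl
halve (suc n) with halve n
... | h , inj₁ n≡2h   = h , inj₂ (cong suc n≡2h)
... | h , inj₂ n≡2h+1 = suc h , inj₁ (trans (cong suc n≡2h+1) (cong suc (sym (ℕP.+-suc h h))))

P-annihilates : ∀ n → 2 ≤ n → ∀ y i → MatrixAction.poly (A n) (coeffP n) n y i ≡ + 0
P-annihilates n 2≤n y with halve n
P-annihilates .(0 ℕ.+ 0)                     ()       y | zero , inj₁ refl
P-annihilates .(suc (0 ℕ.+ 0))               (s≤s ()) y | zero , inj₂ refl
P-annihilates .(suc zero ℕ.+ suc zero)       _        y | suc zero , inj₁ refl =
  EvenCase.P-annihilates 0 y (MatrixAction.L (A 2) y) (λ i → sym (L²≈id y i))
P-annihilates .(suc (suc h) ℕ.+ suc (suc h)) _        y | suc (suc h) , inj₁ refl =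
  EvenCase.P-annihilates (suc h) y (MatrixAction.iter (A _) h y) (λ _ → refl)
P-annihilates .(suc (suc h ℕ.+ suc h))       _        y | suc h , inj₂ refl = OddCase.P-annihilates h y

-- Counting chains

sumℕ : ∀ {m} → (Fin m → ℕ) → ℕ
sumℕ {zero}  f = 0
sumℕ {suc m} f = f zero ℕ.+ sumℕ (f ∘ suc)

+-sumℕ : ∀ {m} (f : Fin m → ℕ) → + sumℕ f ≡ sumFin (λ l → + f l)
+-sumℕ {zero}  f = refl
+-sumℕ {suc m} f =
  trans (ℤP.pos-+ (f zero) (sumℕ (f ∘ suc))) (cong (λ s → + f zero + s) (+-sumℕ (f ∘ suc)))

Fin-sumℕ↔Σ : ∀ {m} (f : Fin m → ℕ) → Fin (sumℕ f) ↔ Σ (Fin m) (Fin ∘ f)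
Fin-sumℕ↔Σ {zero}  f = mk↔ₛ′ (λ ()) (λ ()) (λ ()) (λ ())
Fin-sumℕ↔Σ {suc m} f = ↔-trans +↔⊎ (↔-trans (↔-refl ⊎-↔ Fin-sumℕ↔Σ (f ∘ suc)) Σ-split)
  where
  Σ-split : (Fin (f zero) ⊎ Σ (Fin m) (Fin ∘ f ∘ suc)) ↔ Σ (Fin (suc m)) (Fin ∘ f)
  Σ-split = mk↔ₛ′
    (λ { (inj₁ x) → zero , x ; (inj₂ (l , x)) → suc l , x })
    (λ { (zero , x) → inj₁ x ; (suc l , x) → inj₂ (l , x) })
    (λ { (zero , x) → refl ; (suc l , x) → refl })
    (λ { (inj₁ x) → refl ; (inj₂ (l , x)) → refl })

Fin-∣z∣*↔ : ∀ {z : ℤ} w → z ≡ + 0 ⊎ z ≡ + 1 → Fin (ℤ.∣ z ∣ ℕ.* w) ↔ (z ≡ + 1 × Fin w)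
Fin-∣z∣*↔ w (inj₁ refl) = mk↔ₛ′ (λ ()) (λ { (() , _) }) (λ { (() , _) }) (λ ())
Fin-∣z∣*↔ w (inj₂ refl) =
  ↔-trans (subst (λ m → Fin (w ℕ.+ 0) ↔ Fin m) (ℕP.+-identityʳ w) ↔-refl)
          (mk↔ₛ′ (refl ,_) proj₂ (λ { (refl , x) → refl }) (λ _ → refl))

module Walks {n} (M : Matrix n) (M-01 : ∀ i j → M i j ≡ + 0 ⊎ M i j ≡ + 1) where

  Walk : ℕ → Fin n → Set
  Walk k i = Σ[ v ∈ Vec (Fin n) k ] IsChain M (i ∷ v)

  walks : ℕ → Fin n → ℕ
  walks zero    i = 1
  walks (suc k) i = sumℕ (λ l → ℤ.∣ M i l ∣ ℕ.* walks k l)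

  walks↔Walk : ∀ k i → Fin (walks k i) ↔ Walk k i
  walks↔Walk zero    i =
    mk↔ₛ′ (λ _ → [] , tt) (λ _ → zero) (λ { ([] , tt) → refl }) (λ { zero → refl })
  walks↔Walk (suc k) i =
    ↔-trans (Fin-sumℕ↔Σ (λ l → ℤ.∣ M i l ∣ ℕ.* walks k l))
            (↔-trans (Dependent.congˡ (Fin-∣z∣*↔ (walks k _) (M-01 i _)))
                     (↔-trans (Dependent.congˡ (↔-refl ×-↔ walks↔Walk k _)) cons↔))
    where
    cons↔ : Σ (Fin n) (λ l → M i l ≡ + 1 × Walk k l) ↔ Walk (suc k) i
    cons↔ = mk↔ₛ′ (λ { (l , p , v , c) → (l ∷ v) , p , c }) (λ { ((l ∷ v) , p , c) → l , p , v , c })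
                  (λ { ((l ∷ v) , p , c) → refl }) (λ { (l , p , v , c) → refl })

  walks-row-sum : ∀ k i → + walks k i ≡ sumFin (λ j → (M ^^ k) i j)
  walks-row-sum zero    i = sym (begin
    sumFin {n} (λ j → [ toℕ i ≐ toℕ j ])
      ≡⟨ sumFin-cong {n} (λ j → trans (≐-sym (toℕ i) (toℕ j)) (sym (ℤP.*-identityˡ _))) ⟩
    sumFin {n} (λ j → + 1 * [ toℕ j ≐ toℕ i ])
      ≡⟨ sumFin-pick (λ _ → + 1) (toℕ<n i) ⟩
    + 1 ∎)
    where open ≡-Reasoning
  walks-row-sum (suc k) i = begin
    + sumℕ (λ l → ℤ.∣ M i l ∣ ℕ.* walks k l)
      ≡⟨ +-sumℕ (λ l → ℤ.∣ M i l ∣ ℕ.* walks k l) ⟩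
    sumFin (λ l → + (ℤ.∣ M i l ∣ ℕ.* walks k l))
      ≡⟨ sumFin-cong (λ l → trans (ℤP.pos-* ℤ.∣ M i l ∣ (walks k l))
                                  (cong₂ _*_ (nonneg (M-01 i l)) (walks-row-sum k l))) ⟩
    sumFin (λ l → M i l * sumFin (λ j → (M ^^ k) l j))
      ≡⟨ sumFin-cong (λ l → sumFin-*ˡ (M i l) (λ j → (M ^^ k) l j)) ⟩
    sumFin (λ l → sumFin (λ j → M i l * (M ^^ k) l j))
      ≡⟨ sumFin-comm (λ l j → M i l * (M ^^ k) l j) ⟩
    sumFin (λ j → (M ^^ suc k) i j) ∎
    where
    open ≡-Reasoning
    nonneg : ∀ {z} → z ≡ + 0 ⊎ z ≡ + 1 → + ℤ.∣ z ∣ ≡ z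
    nonneg (inj₁ refl) = refl
    nonneg (inj₂ refl) = refl

  chain-count : ∀ k → Σ[ c ∈ ℕ ] ((Fin c ↔ (Σ[ v ∈ Vec (Fin n) (suc k) ] IsChain M v))
                                 × (+ c ≡ sumFin (λ i → sumFin (λ j → (M ^^ k) i j))))
  chain-count k = sumℕ (walks k) , chains↔ , count
    where
    chains↔ : Fin (sumℕ (walks k)) ↔ (Σ[ v ∈ Vec (Fin n) (suc k) ] IsChain M v)
    chains↔ = ↔-trans (Fin-sumℕ↔Σ (walks k)) (↔-trans (Dependent.congˡ (walks↔Walk k _))
      (mk↔ₛ′ (λ { (i , v , c) → (i ∷ v) , c }) (λ { ((i ∷ v) , c) → i , v , c })
             (λ { ((i ∷ v) , c) → refl }) (λ { (i , v , c) → refl })))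
    count : + sumℕ (walks k) ≡ sumFin (λ i → sumFin (λ j → (M ^^ k) i j))
    count = trans (+-sumℕ (walks k)) (sumFin-cong (walks-row-sum k))

theorem2p5 : (n : ℕ) → 2 ≤ n →
    ((i j : Fin n) (m : ℕ) → n < m →
       sumUpTo n (λ t → α n t * (A n ^^ (m ∸ t)) i j) ≡ + 0)
    × ((k : ℕ) → Σ[ c ∈ ℕ ]
         ((Fin c ↔ (Σ[ v ∈ Vec (Fin n) (suc k) ] IsChain (A n) v))
          × (+ c ≡ sumFin (λ i → sumFin (λ j → (A n ^^ k) i j)))))
theorem2p5 n 2≤n =
  (λ i j m n<m → MatrixAction.recurrence (A n) (coeffP n) n (P-annihilates n 2≤n) i j m (ℕP.<⇒≤ n<m)) ,
  Walks.chain-count (A n) (λ i j → 𝟙-01 _)
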